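{- Let $\{G=(V,E),w,T\}$ be a $(k-1)$-stable instance of \texttt{k-terminal cut} with $T=\{t_1,\ldots,t_k\}$. For each $i$, let $E_i$ be the set of edges of the $t_i$-isolating cut, and let $E_{\text{ISO}}$ be the union of the sets $E_1,\ldots,E_k$ except for the $E_i$ of largest weight. Then $E_{\text{ISO}}$ is the unique optimal solution to \texttt{k-terminal cut} on this instance.
   Context: An instance $\{G=(V,E),w,T\}$ of \texttt{k-terminal cut} consists of an undirected graph $G=(V,E)$, a weight function $w:E\to\mathbb{R}^+$, and a set $T=\{t_1,\ldots,t_k\}\subseteq V$ of $k$ distinct terminals. The problem is to remove a minimum-weight set of edges so that no path connects any two terminals; the weight of an edge set is the sum of its edge weights. For $\gamma>1$, a $\gamma$-perturbation of $(G,w)$ is the same graph with weights $w'$ satisfying $w(e)\le w'(e)\le\gamma w(e)$ for all $e\in E$. The instance is $\gamma$-stable if there is an optimal solution $E_{\text{OPT}}$ which is the unique optimal \texttt{k-terminal cut} solution for every $\gamma$-perturbation. The $t_i$-isolating cut is a minimum $(s,t)$-cut separating $s=t_i$ from all other terminals (with $T\setminus\{t_i\}$ merged into a single sink $t$); $E_i$ denotes its set of cut edges.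
   Formalization: The edge weights w and the weights w' of every γ-perturbation are rational rather than real. -}

module Defs where

open import Data.Nat using (ℕ; _∸_)
open import Data.Integer using (+_)
open import Data.Fin using (Fin; _≟_)
open import Data.Fin.Properties using ()
open import Data.Bool using (Bool; true; false; _∧_; not)
open import Data.List using (List; foldr; map)
open import Data.Bool.ListAction using (any)
open import Data.List using (allFin)
open import Data.Product using (_×_; _,_; proj₁; proj₂)
open import Data.Sum using (_⊎_)
open import Data.Rational using (ℚ; 0ℚ; _+_; _*_; _≤_; _<_; _/_)
open import Relation.Binary.PropositionalEquality using (_≡_; _≢_)
open import Relation.Nullary using (¬_)
open import Relation.Nullary.Decidable using (⌊_⌋)

record Graph (n m : ℕ) : Set where
  field
    ends       : Fin m → Fin n × Fin n
    noLoop     : ∀ e → proj₁ (ends e) ≢ proj₂ (ends e)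
    noParallel : ∀ e f →
      (proj₁ (ends e) ≡ proj₁ (ends f) × proj₂ (ends e) ≡ proj₂ (ends f)) ⊎
      (proj₁ (ends e) ≡ proj₂ (ends f) × proj₂ (ends e) ≡ proj₁ (ends f)) →
      e ≡ f
open Graph public

EdgeSet : ℕ → Set
EdgeSet m = Fin m → Bool

weight : ∀ {m} → (Fin m → ℚ) → EdgeSet m → ℚ
weight w F = foldr _+_ 0ℚ (map (λ e → if F e then w e else 0ℚ) (allFin _))
  where
  open import Data.Bool using (if_then_else_)

data Reach {n m} (G : Graph n m) (F : EdgeSet m) : Fin n → Fin n → Set where
  here  : ∀ {u} → Reach G F u u
  fwd   : ∀ {u v} e → F e ≡ false → proj₁ (ends G e) ≡ u →
          Reach G F (proj₂ (ends G e)) v → Reach G F u v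
  bwd   : ∀ {u v} e → F e ≡ false → proj₂ (ends G e) ≡ u →
          Reach G F (proj₁ (ends G e)) v → Reach G F u v

IsTerminalCut : ∀ {n m k} → Graph n m → (Fin k → Fin n) → EdgeSet m → Set
IsTerminalCut G t F = ∀ i j → i ≢ j → ¬ Reach G F (t i) (t j)

IsOptimal : ∀ {n m k} → Graph n m → (Fin m → ℚ) → (Fin k → Fin n) → EdgeSet m → Set
IsOptimal G w t F =
  IsTerminalCut G t F × (∀ F' → IsTerminalCut G t F' → weight w F ≤ weight w F')

IsUniqueOptimal : ∀ {n m k} → Graph n m → (Fin m → ℚ) → (Fin k → Fin n) → EdgeSet m → Set
IsUniqueOptimal G w t F =
  IsOptimal G w t F × (∀ F' → IsOptimal G w t F' → ∀ e → F' e ≡ F e)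

IsPerturbation : ∀ {m} → ℚ → (Fin m → ℚ) → (Fin m → ℚ) → Set
IsPerturbation γ w w' = ∀ e → (w e ≤ w' e) × (w' e ≤ γ * w e)

IsStable : ∀ {n m k} → ℚ → Graph n m → (Fin m → ℚ) → (Fin k → Fin n) → Set
IsStable {m = m} γ G w t =
  Data.Product.Σ (EdgeSet m) λ F →
    ∀ (w' : Fin m → ℚ) → IsPerturbation γ w w' → IsUniqueOptimal G w' t F

IsolatesTerminal : ∀ {n m k} → Graph n m → (Fin k → Fin n) → Fin k → EdgeSet m → Set
IsolatesTerminal G t i F = ∀ j → i ≢ j → ¬ Reach G F (t i) (t j)

-- F is a t_i-isolating cut: a minimum-weight cut separating t_i from all other
-- terminals (equivalently, a minimum (t_i, t)-cut with T \ {t_i} merged into t).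
IsIsolatingCut : ∀ {n m k} → Graph n m → (Fin m → ℚ) → (Fin k → Fin n) → Fin k → EdgeSet m → Set
IsIsolatingCut G w t i F =
  IsolatesTerminal G t i F ×
  (∀ F' → IsolatesTerminal G t i F' → weight w F ≤ weight w F')

unionExcept : ∀ {m k} → (Fin k → EdgeSet m) → Fin k → EdgeSet m
unionExcept {k = k} E j e = any (λ i → not ⌊ i ≟ j ⌋ ∧ E i e) (allFin k)

-- The rational number k - 1 (truncated subtraction; k ≥ 1 whenever a terminal exists).
kMinus1 : ℕ → ℚ
kMinus1 k = + (k ∸ 1) / 1

{-# OPTIONS --safe #-}
module Submission where

-- Let O be the stable optimum. It suffices to show E i ⊆ O for every i: the union of all E i but
-- one is then a terminal cut inside O, hence optimal, hence equal to O.
--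
-- Suppose an edge e₀ of E = E i lies outside O. Let R be the side of t_i in G − E, label every
-- vertex by the terminal it reaches in G − O, and let Π be the class of t_i. With X = δR ∖ O,
-- Y the edges of O inside R and Z the edges of δΠ outside R, uncrossing δR with δΠ (both
-- δ(R ∩ Π) and δ(R ∪ Π) isolate t_i) gives w(X) ≤ w(Y) + w(Z). On the other hand, for each label
-- l ≠ i, moving R into the class of t_i and Π ∖ R into the class of t_l gives a terminal cut F_l
-- containing e₀; multiplying the weights of O ∖ F_l by γ keeps O uniquely optimal, whence
-- γ w(O ∖ F_l) < w(F_l ∖ O) ≤ w(X). As O ∖ F_l contains Y and the edges of Z between the classes
-- of t_i and t_l, summing over the γ = k − 1 labels l ≠ i yields w(Y) + w(Z) < w(X).

open import Defs
open import Data.Nat using (ℕ)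
open import Data.Fin using (Fin)
open import Data.Rational using (ℚ; 0ℚ; _≤_; _<_)
open import Function.Definitions using (Injective)
open import Relation.Binary.PropositionalEquality using (_≡_)

open import Algebra.Bundles using (CommutativeMonoid)
open import Algebra.Properties.CommutativeSemigroup using (interchange)
open import Data.Bool using (Bool; true; false; not; _∧_; _∨_; if_then_else_)
open import Data.Bool.Instances
open import Data.Bool.Properties using (¬-not; T-≡; T-∧)
open import Data.Empty using (⊥; ⊥-elim)
import Data.Fin as Fin
open import Data.Fin using (zero; suc; punchIn; punchOut)
open import Data.Fin.Instances
open import Data.Fin.Properties using (any?; punchInᵢ≢i; punchIn-punchOut)
import Data.Integer as ℤ
import Data.Integer.Properties as ℤₚ
open import Data.List using (List; []; _∷_; foldr; map; length; allFin)
open import Data.List.Membership.Propositional using (_∈_; lose)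
open import Data.List.Membership.Propositional.Properties using (∈-allFin)
open import Data.List.Properties using (length-tabulate)
open import Data.List.Relation.Unary.Any using (here; there; satisfied)
open import Data.List.Relation.Unary.Any.Properties using (any⁺; any⁻)
import Data.Nat as ℕ
import Data.Nat.Properties as ℕₚ
open import Data.Nat.Coprimality using (1-coprimeTo)
import Data.Nat.Coprimality as Coprimality
open import Data.Product using (∃; _×_; _,_; proj₁; proj₂)
open import Data.Rational using (1ℚ; _+_; _*_; _/_; mkℚ; *≤*; NonNegative; nonNegative; toℚᵘ)
open import Data.Rational.Properties
  using ( ≤-refl; ≤-trans; <⇒≤; <-irrefl; <-≤-trans; ≮⇒≥; ≰⇒>; module ≤-Reasoning
        ; +-assoc; +-identityˡ; +-identityʳ; +-0-commutativeMonoid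
        ; *-identityˡ; *-zeroˡ; *-zeroʳ; *-distribˡ-+; *-distribʳ-+
        ; +-mono-≤; +-monoˡ-≤; +-monoʳ-≤; +-monoˡ-<; +-mono-<-≤; +-mono-≤-<
        ; *-monoʳ-≤-nonNeg; *-monoˡ-≤-nonNeg; *-cancelˡ-<-nonNeg
        ; normalize-coprime; toℚᵘ-injective; toℚᵘ-homo-+ )
import Data.Rational.Unnormalised as ℚᵘ
import Data.Rational.Unnormalised.Properties as ℚᵘₚ
open import Function using (_∘_; id)
open import Function.Bundles using (Equivalence)
open import Relation.Binary.PropositionalEquality
  using (_≢_; refl; sym; trans; cong; cong₂; subst; subst₂; module ≡-Reasoning)
open import Relation.Binary.Structures using (IsDecEquivalence)
open import Relation.Binary.TypeClasses using (_≟_)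
open import Relation.Nullary using (¬_; Dec; yes; no; does)
open import Relation.Nullary.Decidable
  using (⌊_⌋; dec-true; dec-false; decidable-stable; ¬¬-excluded-middle; toWitnessFalse; fromWitnessFalse)

open Equivalence using (to; from)

<⇒≱ : ∀ {p q : ℚ} → p < q → ¬ q ≤ p
<⇒≱ p<q q≤p = <-irrefl refl (<-≤-trans p<q q≤p)

+-cancelʳ-≤ : ∀ {p q} r → p + r ≤ q + r → p ≤ q
+-cancelʳ-≤ r p+r≤q+r = ≮⇒≥ λ q<p → <⇒≱ (+-monoˡ-< r q<p) p+r≤q+r

+-cancelˡ-< : ∀ {p q} r → r + p < r + q → p < q
+-cancelˡ-< r r+p<r+q = ≰⇒> λ q≤p → <⇒≱ r+p<r+q (+-monoʳ-≤ r q≤p)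

q≤c*q : ∀ {c q} → 1ℚ ≤ c → 0ℚ ≤ q → q ≤ c * q
q≤c*q {c} {q} 1≤c 0≤q = subst (_≤ c * q) (*-identityˡ q) (*-monoʳ-≤-nonNeg q {{nonNegative 0≤q}} 1≤c)

fromℕ : ℕ → ℚ
fromℕ n = ℤ.+ n / 1

fromℕ≡mkℚ : ∀ n → fromℕ n ≡ mkℚ (ℤ.+ n) 0 (Coprimality.sym (1-coprimeTo n))
fromℕ≡mkℚ n = normalize-coprime _

fromℕ-suc : ∀ n → fromℕ (ℕ.suc n) ≡ 1ℚ + fromℕ n
fromℕ-suc n = toℚᵘ-injective (begin
  toℚᵘ (fromℕ (ℕ.suc n))         ≡⟨ cong toℚᵘ (fromℕ≡mkℚ (ℕ.suc n)) ⟩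
  ℚᵘ.mkℚᵘ (ℤ.+ ℕ.suc n) 0        ≈⟨ ℚᵘ.*≡* numerators ⟩
  ℚᵘ.1ℚᵘ ℚᵘ.+ ℚᵘ.mkℚᵘ (ℤ.+ n) 0  ≡⟨ cong (λ p → toℚᵘ 1ℚ ℚᵘ.+ toℚᵘ p) (fromℕ≡mkℚ n) ⟨
  toℚᵘ 1ℚ ℚᵘ.+ toℚᵘ (fromℕ n)    ≈⟨ toℚᵘ-homo-+ 1ℚ (fromℕ n) ⟨
  toℚᵘ (1ℚ + fromℕ n)            ∎)
  where
  open ℚᵘₚ.≃-Reasoning
  numerators : ℤ.+ ℕ.suc n ℤ.* ℤ.+ 1 ≡ (ℤ.+ 1 ℤ.* ℤ.+ 1 ℤ.+ ℤ.+ n ℤ.* ℤ.+ 1) ℤ.* ℤ.+ 1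
  numerators = trans (ℤₚ.*-identityʳ _)
    (sym (trans (ℤₚ.*-identityʳ _) (cong (ℤ._+_ (ℤ.+ 1)) (ℤₚ.*-identityʳ (ℤ.+ n)))))

fromℕ-mono-≤ : ∀ {a b} → a ℕ.≤ b → fromℕ a ≤ fromℕ b
fromℕ-mono-≤ {a} {b} a≤b rewrite fromℕ≡mkℚ a | fromℕ≡mkℚ b =
  *≤* (subst₂ ℤ._≤_ (sym (ℤₚ.*-identityʳ (ℤ.+ a))) (sym (ℤₚ.*-identityʳ (ℤ.+ b)))
    (ℤ.+≤+ a≤b))

1≤fromℕ-suc : ∀ n → 1ℚ ≤ fromℕ (ℕ.suc n)
1≤fromℕ-suc n = fromℕ-mono-≤ {1} {ℕ.suc n} (ℕ.s≤s ℕ.z≤n)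

∑ : {A : Set} → List A → (A → ℚ) → ℚ
∑ xs f = foldr _+_ 0ℚ (map f xs)

module _ {A : Set} where

  ∑-cong : ∀ xs {f g : A → ℚ} → (∀ x → f x ≡ g x) → ∑ xs f ≡ ∑ xs g
  ∑-cong []       f≗g = refl
  ∑-cong (x ∷ xs) f≗g = cong₂ _+_ (f≗g x) (∑-cong xs f≗g)

  ∑-distrib-+ : ∀ xs (f g : A → ℚ) → ∑ xs (λ x → f x + g x) ≡ ∑ xs f + ∑ xs g
  ∑-distrib-+ []       f g = refl
  ∑-distrib-+ (x ∷ xs) f g = trans (cong (f x + g x +_) (∑-distrib-+ xs f g))
    (interchange (CommutativeMonoid.commutativeSemigroup +-0-commutativeMonoid) (f x) (g x) _ _)

  *-distribˡ-∑ : ∀ xs c (f : A → ℚ) → c * ∑ xs f ≡ ∑ xs (λ x → c * f x)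
  *-distribˡ-∑ []       c f = *-zeroʳ c
  *-distribˡ-∑ (x ∷ xs) c f =
    trans (*-distribˡ-+ c (f x) (∑ xs f)) (cong (c * f x +_) (*-distribˡ-∑ xs c f))

  ∑-const : ∀ xs c → ∑ xs (λ (_ : A) → c) ≡ fromℕ (length xs) * c
  ∑-const []       c = sym (*-zeroˡ c)
  ∑-const (x ∷ xs) c = begin
    c + ∑ xs (λ _ → c)            ≡⟨ cong₂ _+_ (sym (*-identityˡ c)) (∑-const xs c) ⟩
    1ℚ * c + fromℕ (length xs) * c ≡⟨ *-distribʳ-+ c 1ℚ (fromℕ (length xs)) ⟨
    (1ℚ + fromℕ (length xs)) * c   ≡⟨ cong (_* c) (fromℕ-suc (length xs)) ⟨
    fromℕ (length (x ∷ xs)) * c    ∎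
    where open ≡-Reasoning

  ∑-mono-≤ : ∀ xs {f g : A → ℚ} → (∀ x → f x ≤ g x) → ∑ xs f ≤ ∑ xs g
  ∑-mono-≤ []       f≤g = ≤-refl
  ∑-mono-≤ (x ∷ xs) f≤g = +-mono-≤ (f≤g x) (∑-mono-≤ xs f≤g)

  ∑-mono-< : ∀ {xs y} {f g : A → ℚ} → (∀ x → f x ≤ g x) → y ∈ xs → f y < g y → ∑ xs f < ∑ xs g
  ∑-mono-< {x ∷ xs} f≤g (here refl) fy<gy = +-mono-<-≤ fy<gy (∑-mono-≤ xs f≤g)
  ∑-mono-< {x ∷ xs} f≤g (there y∈xs) fy<gy = +-mono-≤-< (f≤g x) (∑-mono-< f≤g y∈xs fy<gy)

∑-allFin-const : ∀ n c → ∑ (allFin n) (λ _ → c) ≡ fromℕ n * c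
∑-allFin-const n c = trans (∑-const (allFin n) c) (cong (λ l → fromℕ l * c) (length-tabulate {n = n} id))

∑-comm : ∀ {A B : Set} xs ys (f : A → B → ℚ) →
  ∑ xs (λ x → ∑ ys (f x)) ≡ ∑ ys (λ y → ∑ xs (λ x → f x y))
∑-comm []       ys f = sym (trans (∑-const ys 0ℚ) (*-zeroʳ (fromℕ (length ys))))
∑-comm (x ∷ xs) ys f = trans (cong (∑ ys (f x) +_) (∑-comm xs ys f))
  (sym (∑-distrib-+ ys (f x) (λ y → ∑ xs (λ x′ → f x′ y))))

count : List Bool → ℕ
count []           = 0
count (true ∷ bs)  = ℕ.suc (count bs)
count (false ∷ bs) = count bs

count-map-∈ : ∀ {A : Set} {xs x} (p : A → Bool) → x ∈ xs → p x ≡ true → 1 ℕ.≤ count (map p xs)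
count-map-∈ {xs = y ∷ ys} p (here refl) px rewrite px = ℕ.s≤s ℕ.z≤n
count-map-∈ {xs = y ∷ ys} p (there x∈ys) px with p y
... | true  = ℕ.s≤s ℕ.z≤n
... | false = count-map-∈ p x∈ys px

count-singleton-≤ : ∀ {b n} → (b ≡ true → 1 ℕ.≤ n) → count (b ∷ []) ℕ.≤ n
count-singleton-≤ {true}  1≤n = 1≤n refl
count-singleton-≤ {false} _   = ℕ.z≤n

ind : Bool → ℚ → ℚ
ind b q = if b then q else 0ℚ

ind-mono : ∀ {b c q} → 0ℚ ≤ q → (b ≡ true → c ≡ true) → ind b q ≤ ind c q
ind-mono {true}          0≤q b⇒c rewrite b⇒c refl = ≤-refl
ind-mono {false} {true}  0≤q b⇒c = 0≤q
ind-mono {false} {false} 0≤q b⇒c = ≤-refl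

∑-ind : ∀ {A : Set} xs (b : A → Bool) q → ∑ xs (λ x → ind (b x) q) ≡ fromℕ (count (map b xs)) * q
∑-ind []       b q = sym (*-zeroˡ q)
∑-ind (x ∷ xs) b q with b x
... | false = trans (+-identityˡ _) (∑-ind xs b q)
... | true  = begin
  q + ∑ xs (λ x → ind (b x) q)          ≡⟨ cong₂ _+_ (sym (*-identityˡ q)) (∑-ind xs b q) ⟩
  1ℚ * q + fromℕ (count (map b xs)) * q ≡⟨ *-distribʳ-+ q 1ℚ (fromℕ (count (map b xs))) ⟨
  (1ℚ + fromℕ (count (map b xs))) * q   ≡⟨ cong (_* q) (fromℕ-suc (count (map b xs))) ⟨
  fromℕ (ℕ.suc (count (map b xs))) * q  ∎
  where open ≡-Reasoning

true≢false : true ≢ false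
true≢false ()

true-ext : ∀ {a b} → (a ≡ true → b ≡ true) → (b ≡ true → a ≡ true) → a ≡ b
true-ext {true}  a⇒b b⇒a = sym (a⇒b refl)
true-ext {false} {true} a⇒b b⇒a = b⇒a refl
true-ext {false} {false} a⇒b b⇒a = refl

∧-true⁻ : ∀ {a b} → a ∧ b ≡ true → a ≡ true × b ≡ true
∧-true⁻ {true} {true} _ = refl , refl

∧-true : ∀ {a b} → a ≡ true → b ≡ true → a ∧ b ≡ true
∧-true refl refl = refl

not-true⁻ : ∀ {a} → not a ≡ true → a ≡ false
not-true⁻ {false} _ = refl

module _ {m : ℕ} where

  infix 4 _⊆_
  infixl 7 _∩_ _∖_

  _⊆_ : EdgeSet m → EdgeSet m → Set
  F ⊆ F′ = ∀ {e} → F e ≡ true → F′ e ≡ true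

  _∩_ _∖_ : EdgeSet m → EdgeSet m → EdgeSet m
  (F ∩ F′) e = F e ∧ F′ e
  (F ∖ F′) e = F e ∧ not (F′ e)

  ⊆-∉ : ∀ {F F′ e} → F ⊆ F′ → F′ e ≡ false → F e ≡ false
  ⊆-∉ F⊆F′ F′e = ¬-not λ Fe → true≢false (trans (sym (F⊆F′ Fe)) F′e)

  ∈-∩⁻ : ∀ {F F′ e} → (F ∩ F′) e ≡ true → F e ≡ true × F′ e ≡ true
  ∈-∩⁻ = ∧-true⁻

  ∈-∖ : ∀ {F F′ e} → F e ≡ true → F′ e ≡ false → (F ∖ F′) e ≡ true
  ∈-∖ Fe F′e = ∧-true Fe (cong not F′e)

  ∈-∖⁻ : ∀ {F F′ e} → (F ∖ F′) e ≡ true → F e ≡ true × F′ e ≡ false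
  ∈-∖⁻ h = proj₁ (∧-true⁻ h) , not-true⁻ (proj₂ (∧-true⁻ h))

module _ {m : ℕ} {w : Fin m → ℚ} (w≥0 : ∀ e → 0ℚ ≤ w e) where

  weight-mono : ∀ {F F′} → F ⊆ F′ → weight w F ≤ weight w F′
  weight-mono F⊆F′ = ∑-mono-≤ (allFin m) λ e → ind-mono (w≥0 e) F⊆F′

  weight-nonNeg : ∀ F → 0ℚ ≤ weight w F
  weight-nonNeg F = subst (_≤ weight w F) (trans (∑-allFin-const m 0ℚ) (*-zeroʳ (fromℕ m)))
    (∑-mono-≤ (allFin m) λ e → ind-mono (w≥0 e) λ ())

  weight-≥⇒⊇ : (∀ e → 0ℚ < w e) → ∀ {F F′} → F ⊆ F′ → weight w F′ ≤ weight w F → F′ ⊆ F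
  weight-≥⇒⊇ w>0 {F} {F′} F⊆F′ F′≤F {e} F′e with F e in Fe
  ... | true  = refl
  ... | false = ⊥-elim (<⇒≱ (∑-mono-< (λ e → ind-mono (w≥0 e) F⊆F′) (∈-allFin e) lt) F′≤F)
    where
    lt : ind (F e) (w e) < ind (F′ e) (w e)
    lt rewrite Fe | F′e = w>0 e

  ∑-weight-mono-count : ∀ {I J : Set} (is : List I) (js : List J) (F : I → EdgeSet m) (F′ : J → EdgeSet m) →
    (∀ e → count (map (λ x → F x e) is) ℕ.≤ count (map (λ y → F′ y e) js)) →
    ∑ is (λ x → weight w (F x)) ≤ ∑ js (λ y → weight w (F′ y))
  ∑-weight-mono-count is js F F′ counts = begin
    ∑ is (λ x → weight w (F x))
      ≡⟨ ∑-comm is (allFin m) _ ⟩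
    ∑ (allFin m) (λ e → ∑ is (λ x → ind (F x e) (w e)))
      ≡⟨ ∑-cong (allFin m) (λ e → ∑-ind is (λ x → F x e) (w e)) ⟩
    ∑ (allFin m) (λ e → fromℕ (count (map (λ x → F x e) is)) * w e)
      ≤⟨ ∑-mono-≤ (allFin m) (λ e → *-monoʳ-≤-nonNeg (w e) {{nonNegative (w≥0 e)}} (fromℕ-mono-≤ (counts e))) ⟩
    ∑ (allFin m) (λ e → fromℕ (count (map (λ y → F′ y e) js)) * w e)
      ≡⟨ ∑-cong (allFin m) (λ e → ∑-ind js (λ y → F′ y e) (w e)) ⟨
    ∑ (allFin m) (λ e → ∑ js (λ y → ind (F′ y e) (w e)))
      ≡⟨ ∑-comm js (allFin m) _ ⟨
    ∑ js (λ y → weight w (F′ y))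
      ∎
    where open ≤-Reasoning

  weight-disjoint-+-≤ : ∀ {A B C} → (∀ {e} → A e ≡ true → B e ≡ true → ⊥) → A ⊆ C → B ⊆ C →
    weight w A + weight w B ≤ weight w C
  weight-disjoint-+-≤ {A} {B} {C} disjoint A⊆C B⊆C =
    subst₂ _≤_ (cong (weight w A +_) (+-identityʳ _)) (+-identityʳ _)
      (∑-weight-mono-count (A ∷ B ∷ []) (C ∷ []) id id counts)
    where
    counts : ∀ e → count (A e ∷ B e ∷ []) ℕ.≤ count (C e ∷ [])
    counts e with A e in Ae | B e in Be
    ... | true  | true  = ⊥-elim (disjoint Ae Be)
    ... | true  | false rewrite A⊆C Ae = ℕ.s≤s ℕ.z≤n
    ... | false | true  rewrite B⊆C Be = ℕ.s≤s ℕ.z≤n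
    ... | false | false = ℕ.z≤n

module _ {n m} (G : Graph n m) where

  src dst : Fin m → Fin n
  src e = proj₁ (ends G e)
  dst e = proj₂ (ends G e)

module _ {n m} {G : Graph n m} {F : EdgeSet m} where

  Reach-trans : ∀ {u v x} → Reach G F u v → Reach G F v x → Reach G F u x
  Reach-trans here              q = q
  Reach-trans (fwd e Fe refl p) q = fwd e Fe refl (Reach-trans p q)
  Reach-trans (bwd e Fe refl p) q = bwd e Fe refl (Reach-trans p q)

  Reach-sym : ∀ {u v} → Reach G F u v → Reach G F v u
  Reach-sym here              = here
  Reach-sym (fwd e Fe refl p) = Reach-trans (Reach-sym p) (bwd e Fe refl here)
  Reach-sym (bwd e Fe refl p) = Reach-trans (Reach-sym p) (fwd e Fe refl here)

  Reach-invariant : ∀ {A : Set} (P : Fin n → A) → (∀ e → F e ≡ false → P (src G e) ≡ P (dst G e)) →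
    ∀ {u v} → Reach G F u v → P u ≡ P v
  Reach-invariant P P-edge here              = refl
  Reach-invariant P P-edge (fwd e Fe refl p) = trans (P-edge e Fe) (Reach-invariant P P-edge p)
  Reach-invariant P P-edge (bwd e Fe refl p) = trans (sym (P-edge e Fe)) (Reach-invariant P P-edge p)

Reach-antimono : ∀ {n m} {G : Graph n m} {F F′ u v} → F ⊆ F′ → Reach G F′ u v → Reach G F u v
Reach-antimono             F⊆F′ here             = here
Reach-antimono {F = F} {F′} F⊆F′ (fwd e F′e eq p) =
  fwd e (⊆-∉ {F = F} {F′} F⊆F′ F′e) eq (Reach-antimono F⊆F′ p)
Reach-antimono {F = F} {F′} F⊆F′ (bwd e F′e eq p) =
  bwd e (⊆-∉ {F = F} {F′} F⊆F′ F′e) eq (Reach-antimono F⊆F′ p)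

isolates-⊆ : ∀ {n m k} {G : Graph n m} {t : Fin k → Fin n} {i F F′} →
  F ⊆ F′ → IsolatesTerminal G t i F → IsolatesTerminal G t i F′
isolates-⊆ F⊆F′ isolates j i≢j = isolates j i≢j ∘ Reach-antimono F⊆F′

terminalCut-reach⇒≡ : ∀ {n m k} {G : Graph n m} {t : Fin k → Fin n} {F} →
  IsTerminalCut G t F → ∀ {a b} → Reach G F (t a) (t b) → a ≡ b
terminalCut-reach⇒≡ cut {a} {b} p with a Fin.≟ b
... | yes a≡b = a≡b
... | no  a≢b = ⊥-elim (cut a b a≢b p)

differ : ∀ {A : Set} {{_ : IsDecEquivalence {A = A} _≡_}} → A → A → Bool
differ a b = not (does (a ≟ b))

module _ {n m} (G : Graph n m) where

  δ : ∀ {A : Set} {{_ : IsDecEquivalence {A = A} _≡_}} → (Fin n → A) → EdgeSet m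
  δ P e = differ (P (src G e)) (P (dst G e))

  inside : (Fin n → Bool) → EdgeSet m
  inside a e = a (src G e) ∧ a (dst G e)

  module _ {A : Set} {{_ : IsDecEquivalence {A = A} _≡_}} {P : Fin n → A} {e : Fin m} where

    δ-∈ : P (src G e) ≢ P (dst G e) → δ P e ≡ true
    δ-∈ ≢ = cong not (dec-false (P (src G e) ≟ P (dst G e)) ≢)

    δ-∉ : P (src G e) ≡ P (dst G e) → δ P e ≡ false
    δ-∉ ≡ = cong not (dec-true (P (src G e) ≟ P (dst G e)) ≡)

    δ-∈⁻ : δ P e ≡ true → P (src G e) ≢ P (dst G e)
    δ-∈⁻ e∈δ ≡ with () ← trans (sym e∈δ) (δ-∉ ≡)

    δ-∉⁻ : δ P e ≡ false → P (src G e) ≡ P (dst G e)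
    δ-∉⁻ e∉δ = ≡-from-not (P (src G e) ≟ P (dst G e)) e∉δ
      where
      ≡-from-not : ∀ {X : Set} (x? : Dec X) → not (does x?) ≡ false → X
      ≡-from-not (yes x) _ = x

  Reach-δ : ∀ {A : Set} {{_ : IsDecEquivalence {A = A} _≡_}} {P : Fin n → A} {u v} →
    Reach G (δ P) u v → P u ≡ P v
  Reach-δ {P = P} = Reach-invariant P λ e → δ-∉⁻ {P = P} {e}

  δ-⊆ : ∀ {A : Set} {{_ : IsDecEquivalence {A = A} _≡_}} {P : Fin n → A} {F} →
    (∀ e → F e ≡ false → P (src G e) ≡ P (dst G e)) → δ P ⊆ F
  δ-⊆ {P = P} P-edge {e} e∈δ = ¬-not λ e∉F → δ-∈⁻ {P = P} e∈δ (P-edge e e∉F)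

  inside-disjoint : ∀ {a e} → inside a e ≡ true → inside (not ∘ a) e ≡ true → ⊥
  inside-disjoint {a} {e} in-a in-¬a with a (src G e)
  ... | true  = true≢false (sym in-¬a)
  ... | false = true≢false (sym in-a)

  module _ {k} {t : Fin k → Fin n} where

    δ-isolates : ∀ {i} (a : Fin n → Bool) → a (t i) ≡ true → (∀ j → i ≢ j → a (t j) ≡ false) →
      IsolatesTerminal G t i (δ a)
    δ-isolates a ai aj j i≢j p with () ← trans (sym ai) (trans (Reach-δ {P = a} p) (aj j i≢j))

    δ-isTerminalCut : (P : Fin n → Fin k) → (∀ a → P (t a) ≡ a) → IsTerminalCut G t (δ P)
    δ-isTerminalCut P P∘t≗id a b a≢b p =
      a≢b (trans (sym (P∘t≗id a)) (trans (Reach-δ {P = P} p) (P∘t≗id b)))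

module _ {n m k} {G : Graph n m} {t : Fin k → Fin n} where

  uniqueOptimal-< : ∀ {w O F e} → IsUniqueOptimal G w t O → IsTerminalCut G t F →
    F e ≡ true → O e ≡ false → weight w O < weight w F
  uniqueOptimal-< {F = F} {e} ((_ , O-min) , unique) F-cut Fe Oe = ≰⇒> λ F≤O →
    true≢false (trans (sym Fe) (trans (unique F (F-cut , λ F′ F′-cut → ≤-trans F≤O (O-min F′ F′-cut)) e) Oe))

  uniqueOptimal-⊆ : ∀ {w O U} → (∀ e → 0ℚ ≤ w e) → IsUniqueOptimal G w t O →
    IsTerminalCut G t U → U ⊆ O → IsUniqueOptimal G w t U
  uniqueOptimal-⊆ {w} {O} {U} w≥0 ((_ , O-min) , unique) U-cut U⊆O =
    U-optimal , λ F F-optimal e → trans (unique F F-optimal e) (sym (unique U U-optimal e))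
    where
    U-optimal : IsOptimal G w t U
    U-optimal = U-cut , λ F F-cut → ≤-trans (weight-mono w≥0 U⊆O) (O-min F F-cut)

  uniqueOptimal-∅ : ∀ {w U} → (∀ e → 0ℚ < w e) → (∀ F → IsTerminalCut G t F) →
    (∀ e → U e ≡ false) → IsUniqueOptimal G w t U
  uniqueOptimal-∅ {w} {U} w>0 every-cut U≡∅ = U-optimal , λ F F-optimal e →
    trans (¬-not λ Fe → U∌ (weight-≥⇒⊇ w≥0 w>0 (U⊆ F) (proj₂ F-optimal U (every-cut U)) Fe)) (sym (U≡∅ e))
    where
    w≥0 : ∀ e → 0ℚ ≤ w e
    w≥0 e = <⇒≤ (w>0 e)
    U∌ : ∀ {e} → U e ≡ true → ⊥
    U∌ {e} Ue with () ← trans (sym Ue) (U≡∅ e)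
    U⊆ : ∀ F → U ⊆ F
    U⊆ F Ue = ⊥-elim (U∌ Ue)
    U-optimal : IsOptimal G w t U
    U-optimal = every-cut U , λ F _ → weight-mono w≥0 (U⊆ F)

scaleOn : ∀ {m} → ℚ → EdgeSet m → (Fin m → ℚ) → Fin m → ℚ
scaleOn γ S w e = if S e then γ * w e else w e

scaleOn-isPerturbation : ∀ {m γ} {w : Fin m → ℚ} → 1ℚ ≤ γ → (∀ e → 0ℚ ≤ w e) →
  ∀ S → IsPerturbation γ w (scaleOn γ S w)
scaleOn-isPerturbation 1≤γ w≥0 S e with S e
... | true  = q≤c*q 1≤γ (w≥0 e) , ≤-refl
... | false = ≤-refl , q≤c*q 1≤γ (w≥0 e)

module Stability {n m k} (G : Graph n m) (t : Fin k → Fin n) {γ : ℚ} (1≤γ : 1ℚ ≤ γ)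
  {w : Fin m → ℚ} (w≥0 : ∀ e → 0ℚ ≤ w e) {O : EdgeSet m}
  (stable : ∀ w′ → IsPerturbation γ w w′ → IsUniqueOptimal G w′ t O) where

  uniqueOptimal : IsUniqueOptimal G w t O
  uniqueOptimal = stable w (scaleOn-isPerturbation 1≤γ w≥0 (λ _ → false))

  -- Raising the weights of O ∖ F by the factor γ keeps O the unique optimum, so it stays lighter than F.
  exchange : ∀ {F e} → IsTerminalCut G t F → F e ≡ true → O e ≡ false →
    γ * weight w (O ∖ F) < weight w (F ∖ O)
  exchange {F} F-cut Fe Oe = +-cancelˡ-< (weight w (O ∩ F))
    (subst₂ _<_ weight-O weight-F
      (uniqueOptimal-< (stable w′ (scaleOn-isPerturbation 1≤γ w≥0 (O ∖ F))) F-cut Fe Oe))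
    where
    w′ : Fin m → ℚ
    w′ = scaleOn γ (O ∖ F) w

    scaled-O : ∀ o f q → ind o (if o ∧ not f then γ * q else q) ≡ ind (o ∧ f) q + γ * ind (o ∧ not f) q
    scaled-O true  true  q = sym (trans (cong (q +_) (*-zeroʳ γ)) (+-identityʳ q))
    scaled-O true  false q = sym (+-identityˡ (γ * q))
    scaled-O false f     q = sym (trans (+-identityˡ (γ * 0ℚ)) (*-zeroʳ γ))

    scaled-F : ∀ o f q → ind f (if o ∧ not f then γ * q else q) ≡ ind (o ∧ f) q + ind (f ∧ not o) q
    scaled-F true  true  q = sym (+-identityʳ q)
    scaled-F true  false q = sym (+-identityˡ 0ℚ)
    scaled-F false true  q = sym (+-identityˡ q)
    scaled-F false false q = sym (+-identityˡ 0ℚ)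

    weight-O : weight w′ O ≡ weight w (O ∩ F) + γ * weight w (O ∖ F)
    weight-O = begin
      weight w′ O
        ≡⟨ ∑-cong (allFin m) (λ e → scaled-O (O e) (F e) (w e)) ⟩
      ∑ (allFin m) (λ e → ind ((O ∩ F) e) (w e) + γ * ind ((O ∖ F) e) (w e))
        ≡⟨ ∑-distrib-+ (allFin m) _ _ ⟩
      weight w (O ∩ F) + ∑ (allFin m) (λ e → γ * ind ((O ∖ F) e) (w e))
        ≡⟨ cong (weight w (O ∩ F) +_) (*-distribˡ-∑ (allFin m) γ _) ⟨
      weight w (O ∩ F) + γ * weight w (O ∖ F) ∎
      where open ≡-Reasoning

    weight-F : weight w′ F ≡ weight w (O ∩ F) + weight w (F ∖ O)
    weight-F = trans (∑-cong (allFin m) (λ e → scaled-F (O e) (F e) (w e))) (∑-distrib-+ (allFin m) _ _)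

module _ {m k} (E : Fin k → EdgeSet m) (j : Fin k) where

  unionExcept-∈⁻ : ∀ {e} → unionExcept E j e ≡ true → ∃ λ i → i ≢ j × E i e ≡ true
  unionExcept-∈⁻ e∈U with satisfied (any⁻ _ (allFin k) (from T-≡ e∈U))
  ... | i , T[i≢j∧Eie] with to (T-∧ {x = not ⌊ i Fin.≟ j ⌋}) T[i≢j∧Eie]
  ...   | T[i≢j] , T[Eie] = i , toWitnessFalse T[i≢j] , to T-≡ T[Eie]

  unionExcept-∈ : ∀ {i e} → i ≢ j → E i e ≡ true → unionExcept E j e ≡ true
  unionExcept-∈ {i} {e} i≢j Eie = to T-≡ (any⁺ _ (lose (∈-allFin i)
    (from (T-∧ {x = not ⌊ i Fin.≟ j ⌋}) (fromWitnessFalse i≢j , from T-≡ Eie))))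

  unionExcept-⊆ : ∀ {O} → (∀ i → E i ⊆ O) → unionExcept E j ⊆ O
  unionExcept-⊆ E⊆O e∈U with unionExcept-∈⁻ e∈U
  ... | i , _ , Eie = E⊆O i Eie

  unionExcept-isTerminalCut : ∀ {n} {G : Graph n m} {t : Fin k → Fin n} →
    (∀ i → IsolatesTerminal G t i (E i)) → IsTerminalCut G t (unionExcept E j)
  unionExcept-isTerminalCut isolates a b a≢b p with a Fin.≟ j
  ... | no  a≢j  = isolates-⊆ (unionExcept-∈ a≢j) (isolates a) b a≢b p
  ... | yes refl = isolates-⊆ (unionExcept-∈ b≢a) (isolates b) a b≢a (Reach-sym p)
    where
    b≢a : b ≢ a
    b≢a = a≢b ∘ sym

¬¬-Π-Fin : ∀ {n} {P : Fin n → Set} → (∀ x → ¬ ¬ P x) → ¬ ¬ (∀ x → P x)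
¬¬-Π-Fin {ℕ.zero}  ¬¬P ¬∀P = ¬∀P λ ()
¬¬-Π-Fin {ℕ.suc n} ¬¬P ¬∀P = ¬¬P zero λ P₀ → ¬¬-Π-Fin (λ x → ¬¬P (suc x)) λ P₊ →
  ¬∀P λ { zero → P₀ ; (suc x) → P₊ x }

record SourceSide {n m} (G : Graph n m) (F : EdgeSet m) (u : Fin n) : Set where
  field
    side    : Fin n → Bool
    source  : side u ≡ true
    sound   : ∀ {v} → side v ≡ true → Reach G F u v
    uncut   : ∀ e → F e ≡ false → side (src G e) ≡ side (dst G e)

record TerminalLabelling {n m k} (G : Graph n m) (F : EdgeSet m) (t : Fin k → Fin n) : Set where
  field
    label    : Fin n → Fin k
    terminal : ∀ a → label (t a) ≡ a
    uncut    : ∀ e → F e ≡ false → label (src G e) ≡ label (dst G e)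

module _ {n m} {G : Graph n m} {F : EdgeSet m} where

  sourceSide : ∀ {u} → (∀ v → Dec (Reach G F u v)) → SourceSide G F u
  sourceSide {u} reach? = record
    { side   = side
    ; source = complete here
    ; sound  = sound
    ; uncut  = λ e Fe → true-ext (λ s → complete (Reach-trans (sound s) (fwd e Fe refl here)))
                                 (λ d → complete (Reach-trans (sound d) (bwd e Fe refl here)))
    }
    where
    side : Fin n → Bool
    side v = does (reach? v)
    complete : ∀ {v} → Reach G F u v → side v ≡ true
    complete {v} = dec-true (reach? v)
    sound : ∀ {v} → side v ≡ true → Reach G F u v
    sound {v} with reach? v
    ... | yes p = λ _ → p

  ¬¬-sourceSide : ∀ {u} → ¬ ¬ SourceSide G F u
  ¬¬-sourceSide ¬side = ¬¬-Π-Fin (λ _ → ¬¬-excluded-middle) (¬side ∘ sourceSide)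

  module _ {k} {t : Fin k → Fin n} (F-cut : IsTerminalCut G t F) (default : Fin k) where

    terminalLabelling : (∀ v a → Dec (Reach G F v (t a))) → TerminalLabelling G F t
    terminalLabelling reach? = record
      { label    = label
      ; terminal = λ a → label-reach here
      ; uncut    = uncut
      }
      where
      choose : ∀ {v} → Dec (∃ λ a → Reach G F v (t a)) → Fin k
      choose (yes (a , _)) = a
      choose (no _)        = default

      label : Fin n → Fin k
      label v = choose (any? (reach? v))

      label-reach : ∀ {v a} → Reach G F v (t a) → label v ≡ a
      label-reach {v} {a} p with any? (reach? v)
      ... | yes (b , q) = terminalCut-reach⇒≡ F-cut (Reach-trans (Reach-sym q) p)
      ... | no  none    = ⊥-elim (none (a , p))

      uncut : ∀ e → F e ≡ false → label (src G e) ≡ label (dst G e)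
      uncut e Fe with any? (reach? (src G e))
      ... | yes (a , p) = sym (label-reach (Reach-trans (bwd e Fe refl here) p))
      ... | no  none with any? (reach? (dst G e))
      ...   | yes (b , q) = ⊥-elim (none (b , Reach-trans (fwd e Fe refl here) q))
      ...   | no  _       = refl

    ¬¬-terminalLabelling : ¬ ¬ TerminalLabelling G F t
    ¬¬-terminalLabelling ¬labelling =
      ¬¬-Π-Fin (λ _ → ¬¬-Π-Fin λ _ → ¬¬-excluded-middle) (¬labelling ∘ terminalLabelling)

-- rs, rd: the ends lie in R; ps, pd: the ends lie in Π; o: the edge lies in O, which contains
-- every edge crossing Π.
uncrossing-count : ∀ rs rd ps pd o → (o ≡ false → ps ≡ pd) →
  count (differ rs rd ∧ not o ∷ differ (rs ∧ ps) (rd ∧ pd) ∷ differ (rs ∨ ps) (rd ∨ pd) ∷ []) ℕ.≤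
  count ((rs ∧ rd) ∧ o ∷ (not rs ∧ not rd) ∧ differ ps pd ∷ differ rs rd ∷ differ rs rd ∷ [])
uncrossing-count _     _     true  false false same with () ← same refl
uncrossing-count _     _     false true  false same with () ← same refl
uncrossing-count true  true  true  true  false _ = ℕₚ.≤ᵇ⇒≤ _ _ _
uncrossing-count true  true  false false false _ = ℕₚ.≤ᵇ⇒≤ _ _ _
uncrossing-count true  false true  true  false _ = ℕₚ.≤ᵇ⇒≤ _ _ _
uncrossing-count true  false false false false _ = ℕₚ.≤ᵇ⇒≤ _ _ _
uncrossing-count false true  true  true  false _ = ℕₚ.≤ᵇ⇒≤ _ _ _
uncrossing-count false true  false false false _ = ℕₚ.≤ᵇ⇒≤ _ _ _
uncrossing-count false false true  true  false _ = ℕₚ.≤ᵇ⇒≤ _ _ _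
uncrossing-count false false false false false _ = ℕₚ.≤ᵇ⇒≤ _ _ _
uncrossing-count true  true  true  true  true  _ = ℕₚ.≤ᵇ⇒≤ _ _ _
uncrossing-count true  true  true  false true  _ = ℕₚ.≤ᵇ⇒≤ _ _ _
uncrossing-count true  true  false true  true  _ = ℕₚ.≤ᵇ⇒≤ _ _ _
uncrossing-count true  true  false false true  _ = ℕₚ.≤ᵇ⇒≤ _ _ _
uncrossing-count true  false true  true  true  _ = ℕₚ.≤ᵇ⇒≤ _ _ _
uncrossing-count true  false true  false true  _ = ℕₚ.≤ᵇ⇒≤ _ _ _
uncrossing-count true  false false true  true  _ = ℕₚ.≤ᵇ⇒≤ _ _ _
uncrossing-count true  false false false true  _ = ℕₚ.≤ᵇ⇒≤ _ _ _
uncrossing-count false true  true  true  true  _ = ℕₚ.≤ᵇ⇒≤ _ _ _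
uncrossing-count false true  true  false true  _ = ℕₚ.≤ᵇ⇒≤ _ _ _
uncrossing-count false true  false true  true  _ = ℕₚ.≤ᵇ⇒≤ _ _ _
uncrossing-count false true  false false true  _ = ℕₚ.≤ᵇ⇒≤ _ _ _
uncrossing-count false false true  true  true  _ = ℕₚ.≤ᵇ⇒≤ _ _ _
uncrossing-count false false true  false true  _ = ℕₚ.≤ᵇ⇒≤ _ _ _
uncrossing-count false false false true  true  _ = ℕₚ.≤ᵇ⇒≤ _ _ _
uncrossing-count false false false false true  _ = ℕₚ.≤ᵇ⇒≤ _ _ _

module EscapingEdge
  {n m k} (G : Graph n m) {w : Fin m → ℚ} (w>0 : ∀ e → 0ℚ < w e)
  {t : Fin (ℕ.suc (ℕ.suc k)) → Fin n} {O : EdgeSet m}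
  (stable : ∀ w′ → IsPerturbation (fromℕ (ℕ.suc k)) w w′ → IsUniqueOptimal G w′ t O)
  {i : Fin (ℕ.suc (ℕ.suc k))} {E : EdgeSet m} (isolating : IsIsolatingCut G w t i E)
  (R : SourceSide G E (t i)) (Λ : TerminalLabelling G O t)
  {e₀ : Fin m} (e₀∈E : E e₀ ≡ true) (e₀∉O : O e₀ ≡ false)
  where

  open SourceSide R renaming (side to r; source to r-source; sound to r-sound; uncut to r-uncut)
  open TerminalLabelling Λ renaming (label to L; terminal to L-terminal; uncut to L-uncut)

  K : ℕ
  K = ℕ.suc (ℕ.suc k)

  γ : ℚ
  γ = fromℕ (ℕ.suc k)

  1≤γ : 1ℚ ≤ γ
  1≤γ = 1≤fromℕ-suc k

  instance
    γ-nonNeg : NonNegative γ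
    γ-nonNeg = nonNegative (≤-trans (fromℕ-mono-≤ {0} {1} ℕ.z≤n) 1≤γ)

  w≥0 : ∀ e → 0ℚ ≤ w e
  w≥0 e = <⇒≤ (w>0 e)

  open Stability G t 1≤γ w≥0 stable using (exchange)

  W : EdgeSet m → ℚ
  W = weight w

  r-sink : ∀ j → i ≢ j → r (t j) ≡ false
  r-sink j i≢j = ¬-not λ rtj → proj₁ isolating j i≢j (r-sound rtj)

  π : Fin n → Bool
  π x = does (L x ≟ i)

  π-uncut : ∀ e → O e ≡ false → π (src G e) ≡ π (dst G e)
  π-uncut e e∉O = cong (λ a → does (a ≟ i)) (L-uncut e e∉O)

  δR X Y Z : EdgeSet m
  δR = δ G r
  X  = δR ∖ O
  Y  = inside G r ∩ O
  Z  = inside G (not ∘ r) ∩ δ G π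

  δR⊆E : δR ⊆ E
  δR⊆E = δ-⊆ G {P = r} r-uncut

  E≤δ : ∀ a → a (t i) ≡ true → (∀ j → i ≢ j → a (t j) ≡ false) → W E ≤ W (δ G a)
  E≤δ a ai aj = proj₂ isolating (δ G a) (δ-isolates G a ai aj)

  δR≤δ : ∀ a → a (t i) ≡ true → (∀ j → i ≢ j → a (t j) ≡ false) → W δR ≤ W (δ G a)
  δR≤δ a ai aj = ≤-trans (weight-mono w≥0 δR⊆E) (E≤δ a ai aj)

  π-terminal : ∀ a → π (t a) ≡ does (a ≟ i)
  π-terminal a = cong (λ b → does (b ≟ i)) (L-terminal a)

  -- Uncrossing: δ(R ∩ Π) and δ(R ∪ Π) isolate t_i, so each weighs at least w(E) ≥ w(δR).
  X≤Y+Z : W X ≤ W Y + W Z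
  X≤Y+Z = +-cancelʳ-≤ D (begin
    W X + D                    ≤⟨ +-monoʳ-≤ (W X) (+-mono-≤ δR≤δA (+-monoˡ-≤ 0ℚ δR≤δRC)) ⟩
    ∑ (X ∷ δA ∷ δRC ∷ []) W    ≤⟨ ∑-weight-mono-count w≥0 _ _ id id per-edge ⟩
    ∑ (Y ∷ Z ∷ δR ∷ δR ∷ []) W ≡⟨ +-assoc (W Y) (W Z) D ⟨
    W Y + W Z + D              ∎)
    where
    open ≤-Reasoning
    D : ℚ
    D = W δR + (W δR + 0ℚ)
    δA δRC : EdgeSet m
    δA  = δ G (λ x → r x ∧ π x)
    δRC = δ G (λ x → r x ∨ π x)
    δR≤δA : W δR ≤ W δA
    δR≤δA = δR≤δ (λ x → r x ∧ π x) (cong₂ _∧_ r-source (trans (π-terminal i) (dec-true (i ≟ i) refl)))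
      λ j i≢j → cong (_∧ π (t j)) (r-sink j i≢j)
    δR≤δRC : W δR ≤ W δRC
    δR≤δRC = δR≤δ (λ x → r x ∨ π x) (cong (_∨ π (t i)) r-source)
      λ j i≢j → cong₂ _∨_ (r-sink j i≢j) (trans (π-terminal j) (dec-false (j ≟ i) (i≢j ∘ sym)))
    per-edge : ∀ e → count (X e ∷ δA e ∷ δRC e ∷ []) ℕ.≤ count (Y e ∷ Z e ∷ δR e ∷ δR e ∷ [])
    per-edge e = uncrossing-count (r (src G e)) (r (dst G e)) (π (src G e)) (π (dst G e)) (O e) (π-uncut e)

  merge : Fin K → Fin K → Fin K
  merge l a = if does (a ≟ i) then l else a

  relabel : Fin K → Bool → Fin K → Fin K
  relabel l b a = if b then i else merge l a

  -- Move R into the class of t_i and the rest of that class into the class of t_l.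
  P : Fin K → Fin n → Fin K
  P l x = relabel l (r x) (L x)

  merge-i : ∀ l → merge l i ≡ l
  merge-i l rewrite dec-true (i ≟ i) refl = refl

  merge-≢ : ∀ {l a} → a ≢ i → merge l a ≡ a
  merge-≢ {a = a} a≢i rewrite dec-false (a ≟ i) a≢i = refl

  merge-≢i : ∀ {l} a → l ≢ i → merge l a ≢ i
  merge-≢i a l≢i with a ≟ i
  ... | yes _   = l≢i
  ... | no  a≢i = a≢i

  relabel-≢ : ∀ {l} b b′ a → l ≢ i → b ≢ b′ → relabel l b a ≢ relabel l b′ a
  relabel-≢ true  true  a _   b≢b′ = ⊥-elim (b≢b′ refl)
  relabel-≢ true  false a l≢i _    = merge-≢i a l≢i ∘ sym
  relabel-≢ false true  a l≢i _    = merge-≢i a l≢i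
  relabel-≢ false false a _   b≢b′ = ⊥-elim (b≢b′ refl)

  P-terminal : ∀ l a → P l (t a) ≡ a
  P-terminal l a with a ≟ i
  ... | yes refl = cong (λ b → relabel l b (L (t i))) r-source
  ... | no  a≢i  = trans (cong₂ (relabel l) (r-sink a (a≢i ∘ sym)) (L-terminal a)) (merge-≢ a≢i)

  e₀∈δR : δR e₀ ≡ true
  e₀∈δR = weight-≥⇒⊇ w≥0 w>0 δR⊆E (E≤δ r r-source r-sink) e₀∈E

  e₀∈δP : ∀ {l} → l ≢ i → δ G (P l) e₀ ≡ true
  e₀∈δP {l} l≢i = δ-∈ G {P = P l} λ same →
    relabel-≢ (r (src G e₀)) (r (dst G e₀)) (L (dst G e₀)) l≢i (δ-∈⁻ G {P = r} e₀∈δR)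
      (trans (cong (relabel l (r (src G e₀))) (sym (L-uncut e₀ e₀∉O))) same)

  Zₗ : Fin K → EdgeSet m
  Zₗ l = Z ∖ δ G (P l)

  Z⊆O : Z ⊆ O
  Z⊆O {e} e∈Z = ¬-not λ e∉O →
    δ-∈⁻ G {P = π} (proj₂ (∈-∩⁻ {F = inside G (not ∘ r)} {δ G π} e∈Z)) (π-uncut e e∉O)

  δP∖O⊆X : ∀ l → δ G (P l) ∖ O ⊆ X
  δP∖O⊆X l {e} h with ∈-∖⁻ {F = δ G (P l)} {O} h
  ... | e∈δP , e∉O = ∈-∖ {F = δR} {O} (δ-∈ G {P = r} λ same →
    δ-∈⁻ G {P = P l} e∈δP (cong₂ (relabel l) same (L-uncut e e∉O))) e∉O

  Y⊆O∖δP : ∀ l → Y ⊆ O ∖ δ G (P l)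
  Y⊆O∖δP l {e} h with ∈-∩⁻ {F = inside G r} {O} h
  ... | e-inside , e∈O with ∧-true⁻ {r (src G e)} e-inside
  ... | rs , rd = ∈-∖ {F = O} {δ G (P l)} e∈O (δ-∉ G {P = P l}
    (trans (cong (λ b → relabel l b (L (src G e))) rs) (cong (λ b → relabel l b (L (dst G e))) (sym rd))))

  Zₗ⊆O∖δP : ∀ l → Zₗ l ⊆ O ∖ δ G (P l)
  Zₗ⊆O∖δP l h with ∈-∖⁻ {F = Z} {δ G (P l)} h
  ... | e∈Z , e∉δP = ∈-∖ {F = O} {δ G (P l)} (Z⊆O e∈Z) e∉δP

  per-label : ∀ l → l ≢ i → γ * (W Y + W (Zₗ l)) < W X
  per-label l l≢i = begin-strict
    γ * (W Y + W (Zₗ l))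
      ≤⟨ *-monoˡ-≤-nonNeg γ (weight-disjoint-+-≤ w≥0 disjoint (Y⊆O∖δP l) (Zₗ⊆O∖δP l)) ⟩
    γ * W (O ∖ δ G (P l))
      <⟨ exchange (δ-isTerminalCut G (P l) (P-terminal l)) (e₀∈δP l≢i) e₀∉O ⟩
    W (δ G (P l) ∖ O)
      ≤⟨ weight-mono w≥0 (δP∖O⊆X l) ⟩
    W X
      ∎
    where
    open ≤-Reasoning
    disjoint : ∀ {e} → Y e ≡ true → Zₗ l e ≡ true → ⊥
    disjoint {e} y z = inside-disjoint G {r} {e} (proj₁ (∧-true⁻ {inside G r e} y))
      (proj₁ (∧-true⁻ {inside G (not ∘ r) e} (proj₁ (∈-∖⁻ {F = Z} {δ G (P l)} z))))

  joins : ∀ a b → does (a ≟ i) ≢ does (b ≟ i) → ∃ λ c → c ≢ i × merge c a ≡ merge c b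
  joins a b π≢ with a ≟ i | b ≟ i
  ... | yes refl | yes refl = ⊥-elim (π≢ refl)
  ... | yes refl | no  b≢i  = b , b≢i , refl
  ... | no  a≢i  | yes refl = a , a≢i , refl
  ... | no  _    | no  _    = ⊥-elim (π≢ refl)

  others : List (Fin (ℕ.suc k))
  others = allFin (ℕ.suc k)

  Zₓ : Fin (ℕ.suc k) → EdgeSet m
  Zₓ x = Zₗ (punchIn i x)

  Z-cover : ∀ {e} → Z e ≡ true → ∃ λ x → Zₓ x e ≡ true
  Z-cover {e} e∈Z with ∈-∩⁻ {F = inside G (not ∘ r)} {δ G π} e∈Z
  ... | outside , e∈δπ
    with ∧-true⁻ {not (r (src G e))} outside | joins (L (src G e)) (L (dst G e)) (δ-∈⁻ G {P = π} e∈δπ)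
  ... | ¬rs , ¬rd | c , c≢i , merged = punchOut i≢c , ∈-∖ {F = Z} {δ G (P l)} e∈Z (δ-∉ G {P = P l} (begin
    relabel l (r (src G e)) (L (src G e))
      ≡⟨ cong (λ b → relabel l b (L (src G e))) (not-true⁻ {r (src G e)} ¬rs) ⟩
    merge l (L (src G e))
      ≡⟨ subst (λ l → merge l (L (src G e)) ≡ merge l (L (dst G e))) (sym l≡c) merged ⟩
    merge l (L (dst G e))
      ≡⟨ cong (λ b → relabel l b (L (dst G e))) (not-true⁻ {r (dst G e)} ¬rd) ⟨
    relabel l (r (dst G e)) (L (dst G e))
      ∎))
    where
    open ≡-Reasoning
    i≢c : i ≢ c
    i≢c = c≢i ∘ sym
    l : Fin K
    l = punchIn i (punchOut i≢c)
    l≡c : l ≡ c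
    l≡c = punchIn-punchOut i≢c

  Z≤∑Zₓ : W Z ≤ ∑ others (W ∘ Zₓ)
  Z≤∑Zₓ = subst (_≤ ∑ others (W ∘ Zₓ)) (+-identityʳ (W Z))
    (∑-weight-mono-count w≥0 (Z ∷ []) others id Zₓ λ e → count-singleton-≤ λ e∈Z →
      count-map-∈ (λ x → Zₓ x e) (∈-allFin (proj₁ (Z-cover e∈Z))) (proj₂ (Z-cover e∈Z)))

  -- There are exactly γ labels other than i, so summing the per-label bounds cancels the factor γ:
  -- this is where stability with factor (number of terminals − 1) is needed.
  Y+Z<X : W Y + W Z < W X
  Y+Z<X = begin-strict
    W Y + W Z
      ≤⟨ +-mono-≤ (q≤c*q 1≤γ (weight-nonNeg w≥0 Y)) Z≤∑Zₓ ⟩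
    γ * W Y + ∑ others (W ∘ Zₓ)
      ≡⟨ cong (_+ ∑ others (W ∘ Zₓ)) (∑-allFin-const (ℕ.suc k) (W Y)) ⟨
    ∑ others (λ _ → W Y) + ∑ others (W ∘ Zₓ)
      ≡⟨ ∑-distrib-+ others (λ _ → W Y) (W ∘ Zₓ) ⟨
    ∑ others (λ x → W Y + W (Zₓ x))
      <⟨ *-cancelˡ-<-nonNeg γ averaged ⟩
    W X
      ∎
    where
    open ≤-Reasoning
    per-other : ∀ x → γ * (W Y + W (Zₓ x)) < W X
    per-other x = per-label (punchIn i x) (punchInᵢ≢i i x)
    averaged : γ * ∑ others (λ x → W Y + W (Zₓ x)) < γ * W X
    averaged = subst₂ _<_
      (sym (*-distribˡ-∑ others γ (λ x → W Y + W (Zₓ x)))) (∑-allFin-const (ℕ.suc k) (W X))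
      (∑-mono-< {xs = others} (λ x → <⇒≤ (per-other x)) (here refl) (per-other zero))

  absurd : ⊥
  absurd = <⇒≱ Y+Z<X X≤Y+Z

-- Reachability is not decided here, so the labellings exist only up to double negation;
-- that is enough because the goal O e ≡ true is decidable.
isolatingCut⊆stableOptimum : ∀ {n m k} (G : Graph n m) {w : Fin m → ℚ} → (∀ e → 0ℚ < w e) →
  {t : Fin (ℕ.suc (ℕ.suc k)) → Fin n} {O : EdgeSet m} →
  (∀ w′ → IsPerturbation (fromℕ (ℕ.suc k)) w w′ → IsUniqueOptimal G w′ t O) →
  ∀ i {E} → IsIsolatingCut G w t i E → E ⊆ O
isolatingCut⊆stableOptimum {k = k} G w>0 {t} {O} stable i {E} isolating {e} e∈E =
  decidable-stable (O e ≟ true) λ e∉O →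
  ¬¬-sourceSide {G = G} {E} λ R →
  ¬¬-terminalLabelling O-cut i λ Λ →
  EscapingEdge.absurd G w>0 stable isolating R Λ e∈E (¬-not e∉O)
  where
  O-cut : IsTerminalCut G t O
  O-cut = proj₁ (proj₁ (Stability.uniqueOptimal G t (1≤fromℕ-suc k) (λ e → <⇒≤ (w>0 e)) stable))

corollary1 : ∀ {n m k : ℕ} (G : Graph n m) (w : Fin m → ℚ) (t : Fin k → Fin n) →
    (∀ e → 0ℚ < w e) →
    Injective _≡_ _≡_ t →
    IsStable (kMinus1 k) G w t →
    (E : Fin k → EdgeSet m) →
    (∀ i → IsIsolatingCut G w t i (E i)) →
    (j : Fin k) →
    (∀ i → weight w (E i) ≤ weight w (E j)) →
    IsUniqueOptimal G w t (unionExcept E j)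
corollary1 {k = ℕ.zero} _ _ _ _ _ _ _ _ () _
corollary1 {k = ℕ.suc ℕ.zero} _ _ _ w>0 _ _ _ _ zero _ =
  uniqueOptimal-∅ w>0 (λ { _ zero zero 0≢0 _ → 0≢0 refl }) λ _ → refl
corollary1 {k = ℕ.suc (ℕ.suc k)} G w t w>0 _ (O , stable) E isolating j _ =
  uniqueOptimal-⊆ w≥0 (Stability.uniqueOptimal G t (1≤fromℕ-suc k) w≥0 stable)
    (unionExcept-isTerminalCut E j (proj₁ ∘ isolating))
    (unionExcept-⊆ E j λ i → isolatingCut⊆stableOptimum G w>0 stable i (isolating i))
  where
  w≥0 : ∀ e → 0ℚ ≤ w e
  w≥0 e = <⇒≤ (w>0 e)
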